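{- Let $\mathcal{X}$ be an $n$-premaniplex with a voltage assignment $\xi$ with voltage group $\Gamma$ making $(\mathcal{X},\xi)$ a voltage premaniplex, and let $(\mathcal{Y},\eta)$ be an $(n,m)$-voltage operator. Define $\theta=\theta(\eta,\xi):\Pi(\mathcal{X}\rtimes_\eta\mathcal{Y})\to\Gamma$ by \[\theta\big({}^{\omega}(x,y)\big):=\xi\big({}^{\eta({}^{\omega}y)}x\big)\] for every vertex $(x,y)$ and every $\omega\in\mathrm{Mon}(\mathcal{U}^m)$. Then the derived graph $(\mathcal{X}\rtimes_\eta\mathcal{Y})^\theta$ is isomorphic to $\mathcal{X}^\xi\rtimes_\eta\mathcal{Y}$.
   Context: Graphs may have semiedges and parallel edges. An $n$-premaniplex is a graph whose darts are colored by $\{0,\dots,n-1\}$ (a dart and its inverse have the same color) such that every vertex is the starting point of exactly one dart of each color, and for $|i-j|\ge 2$ every path of length 4 alternating colors $i,j$ is closed. For a vertex $x$, ${}^i x$ denotes the dart of color $i$ starting at $x$, and $x^i$ its endpoint. For each $k$, $\mathrm{Mon}(\mathcal U^k)=\langle r_0,\dots,r_{k-1}\mid r_i^2=1,\ (r_ir_j)^2=1 \text{ for } |i-j|\ge2\rangle$ acts on the left on the vertex set of every $k$-premaniplex by $r_i x=x^i$. Paths are considered up to maniplex homotopy (inserting/deleting two consecutive darts of the same color, or swapping two consecutive colors $i,j$ with $|i-j|\ge2$); $\Pi(\mathcal Z)$ is the set of homotopy classes of paths. For $\omega=r_{i_k}\cdots r_{i_1}$, ${}^{\omega}z$ denotes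 the class of the path starting at $z$ following colors $i_1,\dots,i_k$ in that order (well defined up to homotopy). A voltage assignment $\xi$ with group $G$ assigns $\xi(d)\in G$ to each dart $d$ with $\xi(d^{ -1})=\xi(d)^{ -1}$; the voltage of a path $d_1\cdots d_k$ is $\xi(d_k)\cdots\xi(d_1)$. A voltage premaniplex is a premaniplex with a voltage assignment such that every length-4 path alternating between colors $i,j$ with $|i-j|\ge2$ has trivial voltage (so voltages are defined on $\Pi$). The derived graph $\mathcal Z^\xi$ of a voltage premaniplex has vertex set $V(\mathcal Z)\times G$ and $(z,g)^i=(z^i,\xi({}^i z)g)$. An $(n,m)$-voltage operator is a voltage premaniplex $(\mathcal Y,\eta)$ with $\mathcal Y$ an $m$-premaniplex and voltage group $\mathrm{Mon}(\mathcal U^n)$. For an $n$-premaniplex $\mathcal X$, $\mathcal X\rtimes_\eta\mathcal Y$ is the $m$-premaniplex on $V(\mathcal X)\times V(\mathcal Y)$ where for each color $i$ there is an edge of color $i$ joining $(x,y)$ and $(\eta({}^i y)x,\ y^i)$. -}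

module Defs where

open import Level using (Level; _⊔_) renaming (suc to lsuc)
open import Data.Nat using (ℕ; _≤_; ∣_-_∣)
open import Data.Fin using (Fin; toℕ)
open import Data.List using (List; []; _∷_; _++_; reverse)
open import Data.Product using (_×_; _,_)
open import Relation.Binary.PropositionalEquality using (_≡_)
open import Algebra.Bundles using (Group)

Far : ∀ {n} → Fin n → Fin n → Set
Far i j = 2 ≤ ∣ toℕ i - toℕ j ∣

-- Since every vertex is the start of exactly one dart of
-- each colour, darts of colour i are in bijection with vertices: the dart
-- ^i x is represented by the pair (i , x); its end point is  r i x = x^i
-- and its inverse dart is ^i (x^i).  (A semiedge is the case r i x ≡ x.)

record Premaniplex (n : ℕ) : Set₁ where
  field
    V     : Set
    r     : Fin n → V → V
    invol : ∀ i x → r i (r i x) ≡ x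
    comm  : ∀ i j → Far i j → ∀ x → r j (r i (r j (r i x))) ≡ x

open Premaniplex public

-- Mon(U^n) as the group presented by  r_i^2 = 1, (r_i r_j)^2 = 1 (|i-j|≥2).
-- The element r_{i_k} ⋯ r_{i_1} is represented by the word
-- i_k ∷ ⋯ ∷ i_1 ∷ [] ; product is _++_, identity [], inverse reverse,
-- and equality in the group is the congruence _~_ generated by the relators.

Word : ℕ → Set
Word n = List (Fin n)

infix 4 _~_
data _~_ {n : ℕ} : Word n → Word n → Set where
  rel-sq  : ∀ u v i → (u ++ i ∷ i ∷ v) ~ (u ++ v)
  rel-far : ∀ u v i j → Far i j → (u ++ i ∷ j ∷ i ∷ j ∷ v) ~ (u ++ v)
  ~-refl  : ∀ {u} → u ~ u
  ~-sym   : ∀ {u v} → u ~ v → v ~ u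
  ~-trans : ∀ {u v w} → u ~ v → v ~ w → u ~ w

act : ∀ {n} (X : Premaniplex n) → Word n → V X → V X
act X []      x = x
act X (i ∷ w) x = r X i (act X w x)

module _ {c ℓ : Level} (Γ : Group c ℓ) where
  open Group Γ

  volt : ∀ {n} (X : Premaniplex n) → (Fin n → V X → Carrier) →
         Word n → V X → Carrier
  volt X ξ []      x = ε
  volt X ξ (i ∷ w) x = ξ i (act X w x) ∙ volt X ξ w x

  record VoltagePremaniplex (n : ℕ) : Set (lsuc (c ⊔ ℓ)) where
    field
      X   : Premaniplex n
      ξ   : Fin n → V X → Carrier
      inv : ∀ i x → ξ i (r X i x) ≈ ξ i x ⁻¹
      vp  : ∀ i j → Far i j → ∀ x →
            volt X ξ (j ∷ i ∷ j ∷ i ∷ []) x ≈ ε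

etaW : ∀ {n m} (Y : Premaniplex m) → (Fin m → V Y → Word n) →
       Word m → V Y → Word n
etaW Y η []      y = []
etaW Y η (i ∷ w) y = η i (act Y w y) ++ etaW Y η w y

record VoltageOperator (n m : ℕ) : Set₁ where
  field
    Y   : Premaniplex m
    η   : Fin m → V Y → Word n
    inv : ∀ i y → η i (r Y i y) ~ reverse (η i y)
    vp  : ∀ i j → Far i j → ∀ y →
          etaW Y η (j ∷ i ∷ j ∷ i ∷ []) y ~ []

-- Coloured graphs with one dart of each colour at each vertex, whose vertex
-- set carries an equality relation (needed because group elements are only
-- equal up to the group's _≈_).

record CGraph (n : ℕ) (a b : Level) : Set (lsuc (a ⊔ b)) where
  field
    Vx  : Set a
    _≈v_ : Vx → Vx → Set b
    nb  : Fin n → Vx → Vx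

open CGraph public

toCGraph : ∀ {n} → Premaniplex n → CGraph n Level.zero Level.zero
toCGraph X = record { Vx = V X ; _≈v_ = _≡_ ; nb = r X }

actG : ∀ {n a b} (G : CGraph n a b) → Word n → Vx G → Vx G
actG G []      v = v
actG G (i ∷ w) v = nb G i (actG G w v)

record _≅_ {n a b a' b'} (G : CGraph n a b) (H : CGraph n a' b') :
           Set (a ⊔ b ⊔ a' ⊔ b') where
  field
    to        : Vx G → Vx H
    from      : Vx H → Vx G
    to-cong   : ∀ {u v} → _≈v_ G u v → _≈v_ H (to u) (to v)
    from-cong : ∀ {u v} → _≈v_ H u v → _≈v_ G (from u) (from v)
    to-from   : ∀ v → _≈v_ H (to (from v)) v
    from-to   : ∀ v → _≈v_ G (from (to v)) v
    to-nb     : ∀ i v → _≈v_ H (to (nb G i v)) (nb H i (to v))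

derived : ∀ {n a b c ℓ} (G : CGraph n a b) (Γ : Group c ℓ) →
          (Fin n → Vx G → Group.Carrier Γ) → CGraph n (a ⊔ c) (b ⊔ ℓ)
derived G Γ ξ = record
  { Vx   = Vx G × Carrier
  ; _≈v_ = λ { (z , g) (z' , g') → _≈v_ G z z' × g ≈ g' }
  ; nb   = λ { i (z , g) → nb G i z , ξ i z ∙ g }
  }
  where open Group Γ

_⋊_ : ∀ {n m a b} (G : CGraph n a b) (O : VoltageOperator n m) → CGraph m a b
G ⋊ O = record
  { Vx   = Vx G × V Y
  ; _≈v_ = λ { (x , y) (x' , y') → _≈v_ G x x' × y ≡ y' }
  ; nb   = λ { i (x , y) → actG G (η i y) x , r Y i y }
  }
  where open VoltageOperator O

module _ {n m c ℓ} (Γ : Group c ℓ) (XV : VoltagePremaniplex Γ n)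
         (O : VoltageOperator n m) where
  open VoltagePremaniplex XV
  open VoltageOperator O

  θpath : Word m → V X × V Y → Group.Carrier Γ
  θpath ω (x , y) = volt Γ X ξ (etaW Y η ω y) x

  θ : Fin m → V X × V Y → Group.Carrier Γ
  θ i xy = θpath (i ∷ []) xy

  derivedSemidirect : CGraph m (c) (ℓ)
  derivedSemidirect = derived (toCGraph X ⋊ O) Γ θ

  semidirectDerived : CGraph m (c) (ℓ)
  semidirectDerived = derived (toCGraph X) Γ ξ ⋊ O

{-# OPTIONS --safe #-}
module Submission where

open import Defs
open import Data.Nat using (ℕ)
open import Data.Fin using (Fin)
open import Level using (Level)
open import Algebra.Bundles using (Group)
open import Data.Product using (_×_; _,_; proj₁; proj₂)
open import Data.List using ([]; _∷_)
open import Data.List.Properties using (++-identityʳ)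
open import Relation.Binary.PropositionalEquality using (_≡_; refl; cong; sym; trans)

-- The vertex sets of both graphs are V(X) × V(Y) × Γ up to reordering.  A
-- colour-i step in X^ξ ⋊_η Y walks the path η(^i y) through X^ξ, which moves
-- x along that path and multiplies g by its ξ-voltage; that voltage is
-- exactly θ(^i (x , y)).

actG-toCGraph : ∀ {n} (X : Premaniplex n) w x → actG (toCGraph X) w x ≡ act X w x
actG-toCGraph X []      x = refl
actG-toCGraph X (i ∷ w) x = cong (r X i) (actG-toCGraph X w x)

module _ {c ℓ : Level} (Γ : Group c ℓ) where
  open Group Γ using (Carrier; _≈_; _∙_; identityˡ; assoc; ∙-cong)
    renaming (sym to ≈-sym; trans to ≈-trans; reflexive to ≈-reflexive)

  actG-derived : ∀ {n} (X : Premaniplex n) (ξ : Fin n → V X → Carrier) w x g →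
                 (proj₁ (actG (derived (toCGraph X) Γ ξ) w (x , g)) ≡ act X w x)
                 × (proj₂ (actG (derived (toCGraph X) Γ ξ) w (x , g)) ≈ volt Γ X ξ w x ∙ g)
  actG-derived X ξ []      x g = refl , ≈-sym (identityˡ g)
  actG-derived X ξ (i ∷ w) x g with actG-derived X ξ w x g
  ... | x≡ , g≈ = cong (r X i) x≡
                , ≈-trans (∙-cong (≈-reflexive (cong (ξ i) x≡)) g≈) (≈-sym (assoc _ _ _))

  θ-dart : ∀ {n m} (XV : VoltagePremaniplex Γ n) (O : VoltageOperator n m) i x y →
           θ Γ XV O i (x , y) ≡ volt Γ (VoltagePremaniplex.X XV) (VoltagePremaniplex.ξ XV)
                                        (VoltageOperator.η O i y) x
  θ-dart XV O i x y = cong (λ w → volt Γ X ξ w x) (++-identityʳ (η i y))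
    where open VoltagePremaniplex XV
          open VoltageOperator O

theorem5p4 : ∀ {c ℓ : Level} {n m : ℕ} (Γ : Group c ℓ)
               (XV : VoltagePremaniplex Γ n) (O : VoltageOperator n m) →
               derivedSemidirect Γ XV O ≅ semidirectDerived Γ XV O
theorem5p4 Γ XV O = record
  { to        = to
  ; from      = λ { ((x , g) , y) → (x , y) , g }
  ; to-cong   = λ { ((x≡ , y≡) , g≈) → (x≡ , g≈) , y≡ }
  ; from-cong = λ { ((x≡ , g≈) , y≡) → (x≡ , y≡) , g≈ }
  ; to-from   = λ _ → (refl , ≈-refl) , refl
  ; from-to   = λ _ → (refl , refl) , ≈-refl
  ; to-nb     = λ { i ((x , y) , g) → to-nb i x y g }
  }
  where
  open Group Γ using (Carrier; ∙-congʳ)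
    renaming (refl to ≈-refl; sym to ≈-sym; trans to ≈-trans; reflexive to ≈-reflexive)
  open VoltagePremaniplex XV
  open VoltageOperator O

  to : Vx (derivedSemidirect Γ XV O) → Vx (semidirectDerived Γ XV O)
  to ((x , y) , g) = (x , g) , y

  to-nb : ∀ i x y (g : Carrier) →
          _≈v_ (semidirectDerived Γ XV O)
               (to (nb (derivedSemidirect Γ XV O) i ((x , y) , g)))
               (nb (semidirectDerived Γ XV O) i (to ((x , y) , g)))
  to-nb i x y g with actG-derived Γ X ξ (η i y) x g
  ... | x≡ , g≈ = ( trans (actG-toCGraph X (η i y) x) (sym x≡)
                  , ≈-trans (∙-congʳ (≈-reflexive (θ-dart Γ XV O i x y))) (≈-sym g≈) )
                , refl
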